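{- Let $G$ be a graph that has a nonidentity endomorphism, such that every nonidentity endomorphism of $G$ moves infinitely many vertices, and such that $\operatorname{End}(G)$ is countable. Then $D_e(G) = 2$.
   Context: Graphs are simple. An endomorphism of $G=(V,E)$ is a map $\phi: V\to V$ such that $\phi(u)\phi(v)\in E$ whenever $uv\in E$; $\operatorname{End}(G)$ is the set of all endomorphisms. A labeling $c$ of $V$ is preserved by $\phi$ if $c(\phi(v))=c(v)$ for all $v$. The endomorphism distinguishing number $D_e(G)$ is the least cardinal $d$ such that $G$ has a labeling with $d$ labels preserved only by the identity endomorphism. -}

module Defs where

open import Data.Nat using (ℕ)
open import Data.Fin using (Fin)
open import Data.List using (List)
open import Data.List.Membership.Propositional using (_∈_)
open import Data.Product using (Σ; _×_; ∃)
open import Relation.Nullary using (¬_)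
open import Relation.Binary.PropositionalEquality using (_≡_)

record Graph : Set₁ where
  field
    V     : Set
    E     : V → V → Set
    sym   : ∀ {u v} → E u v → E v u
    irrefl : ∀ {v} → ¬ E v v

module _ (G : Graph) where
  open Graph G

  record Endo : Set where
    constructor endo
    field
      map  : V → V
      hom  : ∀ {u v} → E u v → E (map u) (map v)
  open Endo public

  IsIdentity : Endo → Set
  IsIdentity φ = ∀ v → map φ v ≡ v

  FiniteSet : (V → Set) → Set
  FiniteSet P = Σ (List V) λ xs → ∀ v → P v → v ∈ xs

  InfiniteSet : (V → Set) → Set
  InfiniteSet P = ¬ FiniteSet P

  MovesInfinitelyMany : Endo → Set
  MovesInfinitelyMany φ = InfiniteSet (λ v → ¬ (map φ v ≡ v))

  -- End(G) is countable: some sequence ℕ → End(G) hits every endomorphism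
  -- (up to pointwise equality of maps).  End(G) is nonempty (contains id).
  CountableEnd : Set
  CountableEnd = Σ (ℕ → Endo) λ f → ∀ φ → ∃ λ n → ∀ v → map (f n) v ≡ map φ v

  Preserves : ∀ {d} → (V → Fin d) → Endo → Set
  Preserves c φ = ∀ v → c (map φ v) ≡ c v

  Distinguishing : ∀ {d} → (V → Fin d) → Set
  Distinguishing c = ∀ φ → Preserves c φ → IsIdentity φ

  HasDistLabeling : ℕ → Set
  HasDistLabeling d = Σ (V → Fin d) Distinguishing

  EndoDistNumberIs : ℕ → Set
  EndoDistNumberIs d = HasDistLabeling d × (∀ k → k Data.Nat.< d → ¬ HasDistLabeling k)

module Submission where

-- Enumerate End(G) as φ₀, φ₁, … and build a 2-labeling in stages, each stage a
-- finite partial labeling extending the previous one. At stage n, if φₙ is not the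
-- identity it moves infinitely many vertices, so it moves some v outside the finite
-- set labelled so far; label v opposite to φₙ(v). Every labeling extending all stages
-- is then broken by every nonidentity endomorphism. One label is never enough, since
-- a constant labeling is preserved by the given nonidentity endomorphism.

open import Defs
open import Level using (0ℓ)
open import Axiom.ExcludedMiddle using (ExcludedMiddle)
open import Axiom.DoubleNegationElimination using (em⇒dne)
open import Data.Empty using (⊥-elim)
open import Data.Fin using (Fin; zero; suc; opposite)
open import Data.List using (List; []; _∷_; _++_)
import Data.List as List
open import Data.List.Membership.Propositional using (_∉_)
open import Data.List.Relation.Unary.Any using (here; there)
open import Data.Maybe using (Maybe; just; nothing; fromMaybe; _<∣>_)
open import Data.Maybe.Properties using (just-injective)
open import Data.Nat using (ℕ; zero; suc; _<_; _≤′_; ≤′-refl; ≤′-step; s≤s)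
open import Data.Nat.Properties using (≤-total; ≤⇒≤′)
open import Data.Product using (Σ; ∃; _×_; _,_; proj₁; proj₂)
open import Data.Sum using (inj₁; inj₂)
open import Function using (_∘_)
open import Relation.Binary.Definitions using (DecidableEquality)
open import Relation.Binary.PropositionalEquality
  using (_≡_; _≢_; refl; sym; trans; cong; module ≡-Reasoning)
open import Relation.Nullary using (¬_; yes; no)

opposite-≢ : (b : Fin 2) → opposite b ≢ b
opposite-≢ zero ()
opposite-≢ (suc zero) ()

Fin<2-irrelevant : ∀ {k} → k < 2 → (i j : Fin k) → i ≡ j
Fin<2-irrelevant {1} _ zero zero = refl
Fin<2-irrelevant {suc (suc _)} (s≤s (s≤s ())) _ _

<∣>-fromMaybe : ∀ {A : Set} (d : A) (m : Maybe A) →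
                m <∣> just (fromMaybe d m) ≡ just (fromMaybe d m)
<∣>-fromMaybe d (just _) = refl
<∣>-fromMaybe d nothing = refl

module AssociationList {V : Set} (_≟_ : DecidableEquality V) {A : Set} where

  lookup : List (V × A) → V → Maybe A
  lookup [] u = nothing
  lookup ((x , a) ∷ S) u with u ≟ x
  ... | yes _ = just a
  ... | no _ = lookup S u

  lookup-here : ∀ x a S → lookup ((x , a) ∷ S) x ≡ just a
  lookup-here x a S with x ≟ x
  ... | yes _ = refl
  ... | no x≢x = ⊥-elim (x≢x refl)

  lookup-there : ∀ {u x} a S → u ≢ x → lookup ((x , a) ∷ S) u ≡ lookup S u
  lookup-there {u} {x} a S u≢x with u ≟ x
  ... | yes u≡x = ⊥-elim (u≢x u≡x)
  ... | no _ = refl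

  lookup-∉ : ∀ {u} S → u ∉ List.map proj₁ S → lookup S u ≡ nothing
  lookup-∉ [] _ = refl
  lookup-∉ {u} ((x , a) ∷ S) u∉ with u ≟ x
  ... | yes u≡x = ⊥-elim (u∉ (here u≡x))
  ... | no _ = lookup-∉ S (u∉ ∘ there)

  lookup-++ : ∀ S T u → lookup (S ++ T) u ≡ lookup S u <∣> lookup T u
  lookup-++ [] T u = refl
  lookup-++ ((x , a) ∷ S) T u with u ≟ x
  ... | yes _ = refl
  ... | no _ = lookup-++ S T u

module _ {V A : Set} where

  _⊑_ : (V → Maybe A) → (V → Maybe A) → Set
  p ⊑ q = ∀ {u a} → p u ≡ just a → q u ≡ just a

  chain-⊑ : (p : ℕ → V → Maybe A) → (∀ n → p n ⊑ p (suc n)) →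
            ∀ {m n} → m ≤′ n → p m ⊑ p n
  chain-⊑ p step ≤′-refl = λ eq → eq
  chain-⊑ p step (≤′-step m≤n) = λ eq → step _ (chain-⊑ p step m≤n eq)

  module _ (em : ExcludedMiddle 0ℓ) (default : A)
           (p : ℕ → V → Maybe A) (step : ∀ n → p n ⊑ p (suc n)) where

    limit : V → A
    limit u with em {∃ λ n → ∃ λ a → p n u ≡ just a}
    ... | yes (_ , a , _) = a
    ... | no _ = default

    limit-agrees : ∀ n {u a} → p n u ≡ just a → limit u ≡ a
    limit-agrees n {u} {a} eq with em {∃ λ n → ∃ λ a → p n u ≡ just a}
    ... | no none = ⊥-elim (none (n , a , eq))
    ... | yes (m , b , eq′) with ≤-total m n
    ...   | inj₁ m≤n = just-injective (trans (sym (chain-⊑ p step (≤⇒≤′ m≤n) eq′)) eq)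
    ...   | inj₂ n≤m = just-injective (trans (sym eq′) (chain-⊑ p step (≤⇒≤′ n≤m) eq))

module _ (em : ExcludedMiddle 0ℓ) (G : Graph) where
  open Graph G using (V)

  _≟_ : DecidableEquality V
  _ ≟ _ = em

  open AssociationList _≟_

  PartialLabeling : Set
  PartialLabeling = List (V × Fin 2)

  label : PartialLabeling → V → Maybe (Fin 2)
  label = lookup

  Separates : (V → Maybe (Fin 2)) → Endo G → Set
  Separates p φ = Σ V λ v → Σ (Fin 2) λ b → p (map φ v) ≡ just b × p v ≡ just (opposite b)

  separates⇒¬preserves : ∀ {p φ} (c : V → Fin 2) → (∀ {u a} → p u ≡ just a → c u ≡ a) →
                         Separates p φ → ¬ Preserves G c φ
  separates⇒¬preserves c agrees (v , b , φv-b , v-b) preserves =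
    opposite-≢ b (trans (sym (agrees v-b)) (trans (sym (preserves v)) (agrees φv-b)))

  infinite⇒∃-∉ : ∀ {P : V → Set} → InfiniteSet G P → (xs : List V) → ∃ λ v → P v × v ∉ xs
  infinite⇒∃-∉ infinite xs = em⇒dne em λ none →
    infinite (xs , λ v Pv → em⇒dne em λ v∉xs → none (v , Pv , v∉xs))

  -- The new entries go after S, and lookup returns the first match, so S is extended
  -- and an already labelled φ v keeps its label b.
  separating-extension : (S : PartialLabeling) (φ : Endo G) → MovesInfinitelyMany G φ →
                         Σ PartialLabeling λ T → label S ⊑ label T × Separates (label T) φ
  separating-extension S φ infinite with infinite⇒∃-∉ infinite (List.map proj₁ S)
  ... | v , moved , fresh = S ++ new , extends , v , b , φv-b , v-b
    where
    open ≡-Reasoning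
    b : Fin 2
    b = fromMaybe zero (label S (map φ v))

    new : PartialLabeling
    new = (v , opposite b) ∷ (map φ v , b) ∷ []

    extends : label S ⊑ label (S ++ new)
    extends {u} eq = trans (lookup-++ S new u) (cong (_<∣> label new u) eq)

    φv-b : label (S ++ new) (map φ v) ≡ just b
    φv-b = begin
      label (S ++ new) (map φ v)                 ≡⟨ lookup-++ S new (map φ v) ⟩
      label S (map φ v) <∣> label new (map φ v)  ≡⟨ cong (label S (map φ v) <∣>_) new-φv ⟩
      label S (map φ v) <∣> just b               ≡⟨ <∣>-fromMaybe zero (label S (map φ v)) ⟩
      just b                                     ∎
      where
      new-φv : label new (map φ v) ≡ just b
      new-φv = trans (lookup-there _ _ moved) (lookup-here _ _ _)

    v-b : label (S ++ new) v ≡ just (opposite b)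
    v-b = begin
      label (S ++ new) v              ≡⟨ lookup-++ S new v ⟩
      label S v <∣> label new v       ≡⟨ cong (_<∣> label new v) (lookup-∉ S fresh) ⟩
      label new v                     ≡⟨ lookup-here _ _ _ ⟩
      just (opposite b)               ∎

  refine : PartialLabeling → Endo G → PartialLabeling
  refine S φ with em {MovesInfinitelyMany G φ}
  ... | yes infinite = proj₁ (separating-extension S φ infinite)
  ... | no _ = S

  refine-extends : ∀ S φ → label S ⊑ label (refine S φ)
  refine-extends S φ with em {MovesInfinitelyMany G φ}
  ... | yes infinite = proj₁ (proj₂ (separating-extension S φ infinite))
  ... | no _ = λ eq → eq

  refine-separates : ∀ S φ → MovesInfinitelyMany G φ → Separates (label (refine S φ)) φ
  refine-separates S φ infinite with em {MovesInfinitelyMany G φ}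
  ... | yes infinite′ = proj₂ (proj₂ (separating-extension S φ infinite′))
  ... | no finite = ⊥-elim (finite infinite)

  module _ (enum : ℕ → Endo G) where

    stage : ℕ → PartialLabeling
    stage zero = []
    stage (suc n) = refine (stage n) (enum n)

    stage-extends : ∀ n → label (stage n) ⊑ label (stage (suc n))
    stage-extends n = refine-extends (stage n) (enum n)

    labeling : V → Fin 2
    labeling = limit em zero (label ∘ stage) stage-extends

    labeling-breaks : ∀ n → MovesInfinitelyMany G (enum n) → ¬ Preserves G labeling (enum n)
    labeling-breaks n infinite =
      separates⇒¬preserves {label (stage (suc n))} {enum n} labeling
        (limit-agrees em zero (label ∘ stage) stage-extends (suc n))
        (refine-separates (stage n) (enum n) infinite)

  labeling-distinguishing : (∀ φ → ¬ IsIdentity G φ → MovesInfinitelyMany G φ) →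
                            ((enum , _) : CountableEnd G) → Distinguishing G (labeling enum)
  labeling-distinguishing moves (enum , onto) φ preserves = em⇒dne em λ φ≢id →
    let (n , same) = onto φ in
    labeling-breaks enum n
      (moves (enum n) (λ id → φ≢id (λ v → trans (sym (same v)) (id v))))
      (λ v → trans (cong (labeling enum) (same v)) (preserves v))

corollary5 : ExcludedMiddle 0ℓ → (G : Graph) →
    Σ (Endo G) (λ φ → ¬ IsIdentity G φ) →
    (∀ φ → ¬ IsIdentity G φ → MovesInfinitelyMany G φ) →
    CountableEnd G →
    EndoDistNumberIs G 2
corollary5 em G (φ₀ , φ₀≢id) moves countable =
    (labeling em G (proj₁ countable) , labeling-distinguishing em G moves countable)
  , λ k k<2 (c , distinguishing) →
      φ₀≢id (distinguishing φ₀ λ v → Fin<2-irrelevant k<2 (c (map φ₀ v)) (c v))
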